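{- Let $\{(\mathcal{M}^{(t)},D^{(t)})\}_{1\le t\le n}$ be an online Steiner forest instance and let $\mathscr{C}^{(t)}_i$ be the clusterings produced by the clustering procedure on $(\mathcal{M}^{(t)},D^{(t)})$ (with the conventions in the context). Then for every $t\ge 1$ and every $0\le i\le L^{(t)}+1$ we have $\mathscr{C}^{(t-1)}_i\preceq\mathscr{C}^{(t)}_i$.
   Context: Setting: $\mathcal{M}$ is a metric on terminals with all distances at least $1$; each terminal lies in exactly one demand pair; $(\mathcal{M}^{(t)},D^{(t)})$ consists of the first $t$ demand pairs $D^{(t)}$ and the submetric $\mathcal{M}^{(t)}$ on the arrived terminals $V^{(t)}$. A clustering of a set is a partition into clusters; for clusterings $\mathscr{C}_1,\mathscr{C}_2$ (possibly of different ground sets) write $\mathscr{C}_1\preceq\mathscr{C}_2$ if every cluster of $\mathscr{C}_1$ is contained in some cluster of $\mathscr{C}_2$. For a clustering $\mathscr{C}$ of the terminal set, $\mathcal{M}/\mathscr{C}$ denotes the shortest-path metric on $\mathscr{C}$ of the graph obtained from the complete graph on the terminals (edge costs = distances) by contracting each cluster to a single vertex. Clustering procedure on an instance $(\mathcal{M},D)$ with terminal set $V$: for a terminal $v$ with mate $u$ set $\mathrm{level}(v)=\lceil\log_2 \mathrm{dist}_{\mathcal{M}}(v,u)\rceil$; for a cluster $C$, $\mathrm{level}(C)=\max_{v\in C}\mathrm{level}(v)$; $L=\max_v\mathrm{level}(v)$. $\mathscr{C}_0$ is the partition into singletons. For $i=0,\dots,L$: a cluster $C\in\mathscr{C}_i$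 is $i$-active if $\mathrm{level}(C)\ge i$; the virtual graph $H_i$ has the $i$-active clusters of $\mathscr{C}_i$ as vertices and an edge between $C_1,C_2$ iff $\mathrm{dist}_{\mathcal{M}/\mathscr{C}_i}(C_1,C_2)<2^{i+1}$; $\mathscr{C}_{i+1}$ consists of all non-$i$-active clusters of $\mathscr{C}_i$ together with, for each connected component of $H_i$, the union of the clusters in that component. Superscript $(t)$ denotes the objects for instance $(\mathcal{M}^{(t)},D^{(t)})$. Conventions: for $i\ge L^{(t)}+1$, $\mathscr{C}^{(t)}_i=\mathscr{C}^{(t)}_{L^{(t)}+1}$ and $H^{(t)}_i$ is empty; for $t=0$, $L^{(0)}=0$ and all $\mathscr{C}^{(0)}_i$, $H^{(0)}_i$ are empty.
   Formalization: The distances of the metric $\mathcal{M}$ are rational numbers. -}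

module Defs where

open import Data.Nat as ℕ using (ℕ; zero; suc; _∸_; _^_; _⊔_)
open import Data.Bool using (Bool; true; false; not; if_then_else_)
open import Data.Fin as Fin using (Fin; toℕ)
open import Data.List using (List; []; _∷_; foldr; map; filter; allFin; concatMap)
open import Data.Product using (Σ; _×_; _,_)
open import Data.Sum using (_⊎_)
open import Data.Integer using (+_; ∣_∣)
open import Data.Rational using (ℚ; 0ℚ; 1ℚ; _+_; _≤_; _<_; _/_; _≤?_; ↥_)
open import Relation.Binary.PropositionalEquality using (_≡_; _≢_)
open import Relation.Binary.Construct.Closure.ReflexiveTransitive using (Star)
open import Relation.Nullary.Decidable using (does)

-- Terminal (k , b) is one endpoint of the k-th demand pair (arrival
-- order k = 0,1,...,n-1); its mate is (k , not b).

Terminal : ℕ → Set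
Terminal n = Fin n × Bool

pairIndex : ∀ {n} → Terminal n → Fin n
pairIndex (k , _) = k

mate : ∀ {n} → Terminal n → Terminal n
mate (k , b) = (k , not b)

record Metric (n : ℕ) : Set where
  field
    dist      : Terminal n → Terminal n → ℚ
    dist-self : ∀ x → dist x x ≡ 0ℚ
    dist-sym  : ∀ x y → dist x y ≡ dist y x
    dist-tri  : ∀ x y z → dist x z ≤ dist x y + dist y z
    dist-≥1   : ∀ x y → x ≢ y → 1ℚ ≤ dist x y
open Metric public

-- Terminal v has arrived by time t, i.e. v ∈ V^(t) (its pair is among
-- the first t demand pairs).
Arrived : ∀ {n} → ℕ → Terminal n → Set
Arrived t v = toℕ (pairIndex v) ℕ.< t

-- ⌈log₂ q⌉ for a rational q ≥ 1: the least k with q ≤ 2^k.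
-- (Search bounded by the numerator of q, which suffices since q ≤ ↥q ≤ 2^↥q.)

pow2 : ℕ → ℚ
pow2 k = + (2 ^ k) / 1

ceilLog2 : ℚ → ℕ
ceilLog2 q = go ∣ ↥ q ∣ 0
  where
  go : ℕ → ℕ → ℕ
  go zero    k = k
  go (suc f) k = if does (q ≤? pow2 k) then k else go f (suc k)

module Procedure {n : ℕ} (M : Metric n) where

  level : Terminal n → ℕ
  level v = ceilLog2 (dist M v (mate v))

  arrivedList : ℕ → List (Terminal n)
  arrivedList t =
    concatMap (λ k → (k , false) ∷ (k , true) ∷ [])
              (filter (λ k → toℕ k ℕ.<? t) (allFin n))

  L : ℕ → ℕ
  L t = foldr _⊔_ 0 (map level (arrivedList t))

  -- Walks in the graph obtained from the complete graph on V^(t) by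
  -- contracting the clusters of a clustering given by relation R
  -- ("same cluster").  Walk t R u v c: a walk of cost c from the
  -- cluster of u to the cluster of v (moves inside a cluster are free).
  data Walk (t : ℕ) (R : Terminal n → Terminal n → Set)
       : Terminal n → Terminal n → ℚ → Set where
    stay : ∀ {u v} → R u v → Walk t R u v 0ℚ
    hop  : ∀ {u x y v c} → Arrived t x → Arrived t y → R u x →
           Walk t R y v c → Walk t R u v (dist M x y + c)

  -- dist_{M^(t)/𝒞}(cluster of u, cluster of v) < B
  -- (the shortest-path distance is a minimum over finitely many
  -- simple walks, so it is < B iff some walk has cost < B)
  DistLt : ℕ → (Terminal n → Terminal n → Set) →
           Terminal n → Terminal n → ℚ → Set
  DistLt t R u v B = Σ ℚ (λ c → Walk t R u v c × c < B)

  mutual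
    -- Same t i u v : u and v lie in the same cluster of 𝒞^(t)_i
    -- (for u, v ∈ V^(t)).
    Same : ℕ → ℕ → Terminal n → Terminal n → Set
    Same t zero    u v = u ≡ v
    Same t (suc i) u v =
      Same t i u v ⊎ (Active t i u × Star (Adj t i) u v)

    -- the cluster of u in 𝒞^(t)_i is i-active: level(C) = max over
    -- members ≥ i, i.e. some member has level ≥ i
    Active : ℕ → ℕ → Terminal n → Set
    Active t i u =
      Arrived t u × Σ (Terminal n) (λ w → Arrived t w × Same t i u w × i ℕ.≤ level w)

    -- edge of the virtual graph H^(t)_i between the (active) clusters
    -- of u and v
    Adj : ℕ → ℕ → Terminal n → Terminal n → Set
    Adj t i u v =
      Active t i u × Active t i v × DistLt t (Same t i) u v (pow2 (suc i))

-- 𝒞₁ ⪯ 𝒞₂ for clusterings given by ground sets G₁ ⊆ G₂ and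
-- same-cluster relations: every cluster of 𝒞₁ lies in a cluster of 𝒞₂.

Refines : {A : Set} → (G₁ : A → Set) → (R₁ R₂ : A → A → Set) → Set
Refines G₁ R₁ R₂ = ∀ u v → G₁ u → G₁ v → R₁ u v → R₂ u v

{-# OPTIONS --safe #-}
-- Every ingredient of the clustering procedure (arrived terminals, walks in
-- the contracted metric, activity of clusters, edges of the virtual graphs)
-- only grows when more demand pairs arrive.
module Submission where

open import Defs
open import Data.Nat using (ℕ; _≤_; _∸_; _+_; zero; suc)
open import Data.Nat.Properties using (<-≤-trans; m∸n≤m)
open import Data.Product using (_,_)
open import Data.Sum using (inj₁; inj₂)
import Relation.Binary.Construct.Closure.ReflexiveTransitive as Star

arrived-mono : ∀ {n t t′} → t ≤ t′ → (v : Terminal n) → Arrived t v → Arrived t′ v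
arrived-mono t≤t′ _ v<t = <-≤-trans v<t t≤t′

module Monotone {n : ℕ} (M : Metric n) {t t′ : ℕ} (t≤t′ : t ≤ t′) where
  open Procedure M

  walk-mono : ∀ {R R′ : Terminal n → Terminal n → Set} →
              (∀ {u v} → R u v → R′ u v) →
              ∀ {u v c} → Walk t R u v c → Walk t′ R′ u v c
  walk-mono R⊆R′ (stay r)                    = stay (R⊆R′ r)
  walk-mono R⊆R′ (hop {x = x} {y} ax ay r w) =
    hop (arrived-mono t≤t′ x ax) (arrived-mono t≤t′ y ay) (R⊆R′ r) (walk-mono R⊆R′ w)

  mutual
    same-mono : ∀ i {u v} → Same t i u v → Same t′ i u v
    same-mono zero    u≡v               = u≡v
    same-mono (suc i) (inj₁ s)          = inj₁ (same-mono i s)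
    same-mono (suc i) (inj₂ (a , path)) =
      inj₂ (active-mono i a , Star.map (adj-mono i) path)

    active-mono : ∀ i {u} → Active t i u → Active t′ i u
    active-mono i {u} (au , w , aw , s , i≤level) =
      arrived-mono t≤t′ u au , w , arrived-mono t≤t′ w aw , same-mono i s , i≤level

    adj-mono : ∀ i {u v} → Adj t i u v → Adj t′ i u v
    adj-mono i (au , av , c , w , c<2ⁱ⁺¹) =
      active-mono i au , active-mono i av , c , walk-mono (same-mono i) w , c<2ⁱ⁺¹

same-refines : ∀ {n} (M : Metric n) {t t′} → t ≤ t′ → ∀ i →
               Refines (Arrived {n} t) (Procedure.Same M t i) (Procedure.Same M t′ i)
same-refines M t≤t′ i _ _ _ _ = Monotone.same-mono M t≤t′ i

lemma4p2 : (n : ℕ) (M : Metric n) (t : ℕ) → 1 ≤ t → t ≤ n →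
    (i : ℕ) → i ≤ Procedure.L M t + 1 →
    Refines (Arrived {n} (t ∸ 1)) (Procedure.Same M (t ∸ 1) i) (Procedure.Same M t i)
lemma4p2 n M t _ _ i _ = same-refines M (m∸n≤m t 1) i
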